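{- Let $a,b$ be positive integers and $\Delta\in\mathrm{CONF}(a,b)$. Then $\Delta$ is regular if and only if its dual configuration $\Delta^{*}\in\mathrm{CONF}(b,a)$ is regular.
   Context: $\mathrm{CONF}(a,b)$ is the set of necklaces (circular arrangements up to rotation) of $a$ red and $b$ black beads. For $\Delta\in\mathrm{CONF}(a,b)$ with black beads $B_0,\dots,B_{b-1}$ in cyclic order, its characteristic sequence $\{x_0,\dots,x_{b-1}\}$ lists the number $x_i$ of red beads between $B_i$ and $B_{i+1}$ (indices mod $b$); it is defined up to cyclic shift and has sum $a$. $\Delta$ is regular if $\frac{a}{b}k-1 < x_i+\dots+x_{i+k-1} < \frac{a}{b}k+1$ for all $0\le i\le b-1$ and $1\le k\le 1+\lfloor b/2\rfloor$ (indices mod $b$). The analogous definition applies in $\mathrm{CONF}(b,a)$, with the roles of $a$ and $b$ exchanged. The dual configuration $\Delta^*$ is the necklace obtained from $\Delta$ by switching the color of every bead, red to black and black to red. Thus $\Delta^*\in\mathrm{CONF}(b,a)$, and its characteristic sequence $\{y_0,\dots,y_{a-1}\}$ is given by $y_i$ = the number of black beads between the $i$-th and $(i+1)$-th red beads of $\Delta$. -}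

module Defs where

open import Data.Bool using (Bool; true; false; not)
open import Data.Nat using (ℕ; zero; suc; _+_; _*_; _<_; _≤_; _/_; _%_)
open import Data.List using (List; []; _∷_; length)
open import Data.Product using (_×_; _,_)

-- Beads: true = red, false = black.
-- A necklace in CONF(a,b) is represented by any linear word (a representative
-- of its rotation class) with a red and b black beads.

countRed : List Bool → ℕ
countRed []           = 0
countRed (true ∷ w)   = suc (countRed w)
countRed (false ∷ w)  = countRed w

countBlack : List Bool → ℕ
countBlack []           = 0
countBlack (true ∷ w)   = countBlack w
countBlack (false ∷ w)  = suc (countBlack w)

-- blocks w = (r₀ ∷ r₁ ∷ … ∷ r_{b-1} ∷ [] , t)  for  w = R^{r₀} B R^{r₁} B … R^{r_{b-1}} B R^{t}
blocks : List Bool → List ℕ × ℕ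
blocks []          = [] , 0
blocks (true ∷ w)  with blocks w
... | []     , t = [] , suc t
... | r ∷ rs , t = suc r ∷ rs , t
blocks (false ∷ w) with blocks w
... | rs , t = 0 ∷ rs , t

-- Characteristic sequence (up to cyclic shift): the number of red beads
-- between consecutive black beads, read cyclically.  For
-- w = R^{r₀} B₀ R^{r₁} B₁ … R^{r_{b-1}} B_{b-1} R^{t}
-- this is  (t + r₀) , r₁ , … , r_{b-1}  (gap B_{b-1}→B₀, then B₀→B₁, …).
charSeq : List Bool → List ℕ
charSeq w with blocks w
... | []     , t = []
... | r ∷ rs , t = (t + r) ∷ rs

-- list access with default 0
_!_ : List ℕ → ℕ → ℕ
[]       ! _       = 0
(x ∷ xs) ! zero    = x
(x ∷ xs) ! suc n   = xs ! n

windowSum : List ℕ → ℕ → ℕ → ℕ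
windowSum []       i k       = 0
windowSum (x ∷ xs) i zero    = 0
windowSum (x ∷ xs) i (suc k) =
  ((x ∷ xs) ! ((i + k) % length (x ∷ xs))) + windowSum (x ∷ xs) i k

-- Regularity of a characteristic sequence xs of length b with sum a:
--   for all 0 ≤ i ≤ b-1 and 1 ≤ k ≤ 1 + ⌊b/2⌋,
--   (a/b)k - 1 < x_i + … + x_{i+k-1} < (a/b)k + 1,
-- written after multiplying through by b > 0:
--   a k < b S + b   and   b S < a k + b.
Regular : ℕ → List ℕ → Set
Regular a xs =
  ∀ i k → i < length xs → 1 ≤ k → k ≤ 1 + length xs / 2 →
    (a * k < length xs * windowSum xs i k + length xs)
    × (length xs * windowSum xs i k < a * k + length xs)

dual : List Bool → List Bool
dual []      = []
dual (c ∷ w) = not c ∷ dual w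

module Submission where

-- Read a word w for Δ as a walk: a red bead goes up by b, a black bead down
-- by a; w is balanced when any two prefix heights differ by less than a + b.
-- (1) Δ is regular iff w is balanced.  Up to rotation w is the word
--     R^{x₀} B R^{x₁} B … of its characteristic sequence; its heights after
--     the black beads ("levels") are b·(x₀+…+x_{j-1}) − a·j, and every other
--     height lies between a level and that level + a.  So w is balanced iff
--     the levels differ pairwise by less than b, which is what the window
--     estimates of regularity say, as b·(x_i+…+x_{i+k-1}) − a·k is a
--     difference of levels (windows longer than 1 + ⌊b/2⌋ via complements).
-- (2) Switching colours negates heights and swaps a, b: w balanced iff dual w is.

open import Defs
open import Data.Bool using (Bool; true; false; not)
open import Data.Bool.Properties using (not-involutive)
import Data.Nat as Nat
open Nat using (ℕ; zero; suc; z≤n; s≤s)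
import Data.Nat.Properties as ℕP
open import Data.List using (List; []; _∷_; _++_; length; replicate; take)
open import Data.List.Properties using (take-all; length-++; ++-assoc)
open import Data.Nat.ListAction using (sum)
open import Data.Nat.DivMod using (m<n⇒m%n≡m; [m+n]%n≡m%n; m/n<m; m%n<n; m≡m%n+[m/n]*n)
open import Relation.Nullary using (¬_; yes; no; contradiction)
open import Data.Product using (_×_; _,_; proj₁; proj₂; ∃-syntax)
open import Data.Sum using (_⊎_; inj₁; inj₂)
open import Relation.Binary.PropositionalEquality
import Data.Integer as Int
open Int using (ℤ; +_; -_)
import Data.Integer.Properties as ℤP
open import Data.Integer.Tactic.RingSolver using (solve-∀)
import Data.Nat.Tactic.RingSolver as NatSolver
open import Function.Bundles using (_⇔_; mk⇔; Equivalence)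
open import Function.Properties.Equivalence using () renaming (sym to ⇔-sym; trans to ⇔-trans)
open import Data.Product.Function.NonDependent.Propositional using (_×-⇔_)

<-offset : ∀ {X Y x y} c → X ≡ x Int.+ c → Y ≡ y Int.+ c → (x Int.< y) ⇔ (X Int.< Y)
<-offset {x = x} {y} c refl refl =
  mk⇔ (ℤP.+-monoˡ-< c) (λ X<Y → subst₂ _<_ (cancel x) (cancel y) (ℤP.+-monoˡ-< (- c) X<Y))
  where
  open Int using (_+_; _<_)
  cancel : ∀ z → z + c + - c ≡ z
  cancel z = identity z c
    where
    identity : ∀ (z c : ℤ) → z + c + - c ≡ z
    identity = solve-∀

<-by-offset : ∀ {X Y x y} c → X Int.< Y → X ≡ x Int.+ c → Y ≡ y Int.+ c → x Int.< y
<-by-offset c X<Y eX eY = Equivalence.from (<-offset c eX eY) X<Y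

module Heights (a b : ℕ) where
  open Int using (_+_; _<_)

  step : Bool → ℤ
  step true  = + b
  step false = - + a

  total : List Bool → ℤ
  total []      = + 0
  total (c ∷ w) = step c + total w

  data PrefixHeight : List Bool → ℤ → Set where
    empty : ∀ {w} → PrefixHeight w (+ 0)
    cons  : ∀ {c w h} → PrefixHeight w h → PrefixHeight (c ∷ w) (step c + h)

  Balanced : List Bool → Set
  Balanced w = ∀ {h h′} → PrefixHeight w h → PrefixHeight w h′ → h < h′ + (+ a + + b)

  total-++ : ∀ u v → total (u ++ v) ≡ total u + total v
  total-++ []      v = sym (ℤP.+-identityˡ (total v))
  total-++ (c ∷ u) v = begin
    step c + total (u ++ v)       ≡⟨ cong (λ t → step c + t) (total-++ u v) ⟩
    step c + (total u + total v)  ≡⟨ ℤP.+-assoc (step c) (total u) (total v) ⟨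
    step c + total u + total v    ∎
    where open ≡-Reasoning

  prefixHeight-++ˡ : ∀ u v {h} → PrefixHeight u h → PrefixHeight (u ++ v) h
  prefixHeight-++ˡ u       v empty    = empty
  prefixHeight-++ˡ (c ∷ u) v (cons p) = cons (prefixHeight-++ˡ u v p)

  prefixHeight-++ʳ : ∀ u v {h} → PrefixHeight v h → PrefixHeight (u ++ v) (total u + h)
  prefixHeight-++ʳ []      v {h} p = subst (PrefixHeight v) (sym (ℤP.+-identityˡ h)) p
  prefixHeight-++ʳ (c ∷ u) v {h} p =
    subst (PrefixHeight (c ∷ u ++ v)) (sym (ℤP.+-assoc (step c) (total u) h))
          (cons (prefixHeight-++ʳ u v p))

  prefixHeight-++⁻ : ∀ u v {h} → PrefixHeight (u ++ v) h →
                     PrefixHeight u h ⊎ ∃[ h′ ] (PrefixHeight v h′ × h ≡ total u + h′)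
  prefixHeight-++⁻ []      v {h} p        = inj₂ (h , p , sym (ℤP.+-identityˡ h))
  prefixHeight-++⁻ (c ∷ u) v     empty    = inj₁ empty
  prefixHeight-++⁻ (c ∷ u) v     (cons p) with prefixHeight-++⁻ u v p
  ... | inj₁ q              = inj₁ (cons q)
  ... | inj₂ (h′ , q , refl) = inj₂ (h′ , q , sym (ℤP.+-assoc (step c) (total u) h′))

  balanced-rotate : ∀ u v → total (u ++ v) ≡ + 0 → Balanced (u ++ v) → Balanced (v ++ u)
  balanced-rotate u v closed bal p p′ =
    <-by-offset (total u) (bal (shift p) (shift p′)) (ℤP.+-comm (total u) _) (regroup _)
    where
    closed′ : total u + total v ≡ + 0
    closed′ = trans (sym (total-++ u v)) closed

    shift : ∀ {h} → PrefixHeight (v ++ u) h → PrefixHeight (u ++ v) (total u + h)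
    shift p with prefixHeight-++⁻ v u p
    ... | inj₁ q              = prefixHeight-++ʳ u v q
    ... | inj₂ (h′ , q , refl) = subst (PrefixHeight (u ++ v)) (wrap h′) (prefixHeight-++ˡ u v q)
      where
      wrap : ∀ h′ → h′ ≡ total u + (total v + h′)
      wrap h′ = begin
        h′                         ≡⟨ ℤP.+-identityˡ h′ ⟨
        + 0 + h′                   ≡⟨ cong (_+ h′) closed′ ⟨
        total u + total v + h′     ≡⟨ ℤP.+-assoc (total u) (total v) h′ ⟩
        total u + (total v + h′)   ∎
        where open ≡-Reasoning

    regroup : ∀ h → total u + h + (+ a + + b) ≡ h + (+ a + + b) + total u
    regroup h = identity (total u) h (+ a + + b)
      where
      identity : ∀ (t h n : ℤ) → t + h + n ≡ h + n + t
      identity = solve-∀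

  total-swap : ∀ u v → total (u ++ v) ≡ total (v ++ u)
  total-swap u v = begin
    total (u ++ v)       ≡⟨ total-++ u v ⟩
    total u + total v    ≡⟨ ℤP.+-comm (total u) (total v) ⟩
    total v + total u    ≡⟨ total-++ v u ⟨
    total (v ++ u)       ∎
    where open ≡-Reasoning

  balanced-rotate⇔ : ∀ u v → total (u ++ v) ≡ + 0 → Balanced (u ++ v) ⇔ Balanced (v ++ u)
  balanced-rotate⇔ u v closed =
    mk⇔ (balanced-rotate u v closed) (balanced-rotate v u (trans (total-swap v u) closed))

dual-involutive : ∀ w → dual (dual w) ≡ w
dual-involutive []      = refl
dual-involutive (c ∷ w) = cong₂ _∷_ (not-involutive c) (dual-involutive w)

module Duality (a b : ℕ) where
  open Int using (_+_)
  private
    module H  = Heights a b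
    module H* = Heights b a

  step-dual : ∀ c → H*.step (not c) ≡ - H.step c
  step-dual true  = refl
  step-dual false = sym (ℤP.neg-involutive (+ a))

  prefixHeight-dual : ∀ {w h} → H.PrefixHeight w h → H*.PrefixHeight (dual w) (- h)
  prefixHeight-dual H.empty = H*.empty
  prefixHeight-dual (H.cons {c} {w} {h} p) =
    subst (H*.PrefixHeight (dual (c ∷ w))) negated (H*.cons (prefixHeight-dual p))
    where
    negated : H*.step (not c) + - h ≡ - (H.step c + h)
    negated = begin
      H*.step (not c) + - h   ≡⟨ cong (_+ - h) (step-dual c) ⟩
      - H.step c + - h        ≡⟨ ℤP.neg-distrib-+ (H.step c) h ⟨
      - (H.step c + h)        ∎
      where open ≡-Reasoning

-- Hence a word is balanced exactly when its dual is; we need one direction,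
-- the other follows by applying it to the dual word.
balanced-dual : ∀ a b w → Heights.Balanced a b w → Heights.Balanced b a (dual w)
balanced-dual a b w bal {h} {h′} p p′ = <-by-offset (- h - h′) (bal (undual p′) (undual p))
  (identity₁ h h′) (identity₂ h h′ (+ a) (+ b))
  where
  open Int using (_+_; _-_)
  undual : ∀ {h} → Heights.PrefixHeight b a (dual w) h → Heights.PrefixHeight a b w (- h)
  undual p = subst (λ u → Heights.PrefixHeight a b u _) (dual-involutive w)
                   (Duality.prefixHeight-dual b a p)
  identity₁ : ∀ (h h′ : ℤ) → - h′ ≡ h + (- h - h′)
  identity₁ = solve-∀
  identity₂ : ∀ (h h′ a b : ℤ) → - h + (a + b) ≡ h′ + (b + a) + (- h - h′)
  identity₂ = solve-∀

fromGaps : List ℕ → List Bool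
fromGaps []       = []
fromGaps (z ∷ zs) = replicate z true ++ false ∷ fromGaps zs

prefixSum : List ℕ → ℕ → ℕ
prefixSum zs j = sum (take j zs)

module Levels (a b : ℕ) where
  open Int using (_+_; _*_; _-_; _<_; _≤_)
  open Heights a b

  blockStep : ℕ → ℤ
  blockStep z = + b * + z - + a

  -- level zs j : the height of fromGaps zs right after its j-th black bead.
  level : List ℕ → ℕ → ℤ
  level zs j = + b * + prefixSum zs j - + a * + j

  level-zero : ∀ zs → level zs 0 ≡ + 0
  level-zero zs = identity (+ b) (+ a)
    where
    identity : ∀ (b a : ℤ) → b * + 0 - a * + 0 ≡ + 0
    identity = solve-∀

  level-suc : ∀ z zs j → level (z ∷ zs) (suc j) ≡ blockStep z + level zs j
  level-suc z zs j = identity (+ b) (+ a) (+ z) (+ prefixSum zs j) (+ j)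
    where
    identity : ∀ (b a z p j : ℤ) → b * (z + p) - a * (+ 1 + j) ≡ b * z - a + (b * p - a * j)
    identity = solve-∀

  level-suc+a : ∀ z zs j → blockStep z + (level zs j + + a) ≡ level (z ∷ zs) (suc j) + + a
  level-suc+a z zs j = trans (sym (ℤP.+-assoc (blockStep z) _ (+ a)))
                             (cong (_+ + a) (sym (level-suc z zs j)))

  b+b*n : ∀ n → + b + + b * + n ≡ + b * + suc n
  b+b*n n = identity (+ b) (+ n)
    where
    identity : ∀ (b n : ℤ) → b + b * n ≡ b * (+ 1 + n)
    identity = solve-∀

  total-run : ∀ z → total (replicate z true) ≡ + b * + z
  total-run zero    = sym (ℤP.*-zeroʳ (+ b))
  total-run (suc z) = trans (cong (λ t → + b + t) (total-run z)) (b+b*n z)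

  block-total : ∀ z h → total (replicate z true) + (- + a + h) ≡ blockStep z + h
  block-total z h = trans (cong (_+ (- + a + h)) (total-run z))
                          (sym (ℤP.+-assoc (+ b * + z) (- + a) h))

  total-fromGaps : ∀ zs → total (fromGaps zs) ≡ level zs (length zs)
  total-fromGaps []       = sym (level-zero [])
  total-fromGaps (z ∷ zs) = begin
    total (replicate z true ++ false ∷ fromGaps zs)
      ≡⟨ total-++ (replicate z true) (false ∷ fromGaps zs) ⟩
    total (replicate z true) + (- + a + total (fromGaps zs))
      ≡⟨ block-total z (total (fromGaps zs)) ⟩
    blockStep z + total (fromGaps zs)
      ≡⟨ cong (λ t → blockStep z + t) (total-fromGaps zs) ⟩
    blockStep z + level zs (length zs)
      ≡⟨ level-suc z zs (length zs) ⟨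
    level (z ∷ zs) (length (z ∷ zs))
      ∎
    where open ≡-Reasoning

  run-prefixHeight : ∀ z j w → j Nat.≤ z → PrefixHeight (replicate z true ++ w) (+ b * + j)
  run-prefixHeight z       zero    w _          =
    subst (PrefixHeight _) (sym (ℤP.*-zeroʳ (+ b))) empty
  run-prefixHeight (suc z) (suc j) w (s≤s j≤z) =
    subst (PrefixHeight _) (b+b*n j) (cons (run-prefixHeight z j w j≤z))

  run-prefixHeight⁻ : ∀ z {h} → PrefixHeight (replicate z true) h → ∃[ j ] (j Nat.≤ z × h ≡ + b * + j)
  run-prefixHeight⁻ zero    empty    = 0 , z≤n , sym (ℤP.*-zeroʳ (+ b))
  run-prefixHeight⁻ (suc z) empty    = 0 , z≤n , sym (ℤP.*-zeroʳ (+ b))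
  run-prefixHeight⁻ (suc z) (cons p) with run-prefixHeight⁻ z p
  ... | j , j≤z , refl = suc j , s≤s j≤z , b+b*n j

  level-one : ∀ z zs → + b * + z ≡ level (z ∷ zs) 1 + + a
  level-one z zs = begin
    + b * + z                      ≡⟨ identity (+ b * + z) (+ a) ⟩
    blockStep z + + 0 + + a         ≡⟨ cong (λ t → blockStep z + t + + a) (level-zero zs) ⟨
    blockStep z + level zs 0 + + a  ≡⟨ cong (_+ + a) (level-suc z zs 0) ⟨
    level (z ∷ zs) 1 + + a          ∎
    where
    open ≡-Reasoning
    identity : ∀ (x a : ℤ) → x ≡ x - a + + 0 + a
    identity = solve-∀

  afterBlock : ∀ z zs {h} → PrefixHeight (fromGaps zs) h →
               PrefixHeight (fromGaps (z ∷ zs)) (blockStep z + h)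
  afterBlock z zs {h} p = subst (PrefixHeight _) (block-total z h)
    (prefixHeight-++ʳ (replicate z true) (false ∷ fromGaps zs) (cons p))

  fromGaps-prefixHeight⁻ : ∀ z zs {h} → PrefixHeight (fromGaps (z ∷ zs)) h →
    ∃[ j ] (j Nat.≤ z × h ≡ + b * + j) ⊎ ∃[ h′ ] (PrefixHeight (fromGaps zs) h′ × h ≡ blockStep z + h′)
  fromGaps-prefixHeight⁻ z zs p with prefixHeight-++⁻ (replicate z true) (false ∷ fromGaps zs) p
  ... | inj₁ q                               = inj₁ (run-prefixHeight⁻ z q)
  ... | inj₂ (_ , empty , refl)              =
    inj₁ (z , ℕP.≤-refl , trans (ℤP.+-identityʳ _) (total-run z))
  ... | inj₂ (_ , cons {h = h′} q , refl) = inj₂ (h′ , q , block-total z h′)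

  atBlack : ∀ zs j → j Nat.≤ length zs → PrefixHeight (fromGaps zs) (level zs j)
  atBlack zs       zero    _          = subst (PrefixHeight _) (sym (level-zero zs)) empty
  atBlack (z ∷ zs) (suc j) (s≤s j≤n) =
    subst (PrefixHeight _) (sym (level-suc z zs j)) (afterBlock z zs (atBlack zs j j≤n))

  beforeBlack : ∀ zs j → j Nat.< length zs → PrefixHeight (fromGaps zs) (level zs (suc j) + + a)
  beforeBlack (z ∷ zs) zero    _          =
    subst (PrefixHeight _) (level-one z zs) (run-prefixHeight z z _ ℕP.≤-refl)
  beforeBlack (z ∷ zs) (suc j) (s≤s j<n) =
    subst (PrefixHeight _) (level-suc+a z zs (suc j)) (afterBlock z zs (beforeBlack zs j j<n))

  -- Conversely, every prefix height lies between some level and some level + a: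
  -- heights only rise along a run of red beads and drop by a at a black bead.
  below : ∀ zs {h} → PrefixHeight (fromGaps zs) h → ∃[ j ] (j Nat.≤ length zs × level zs j ≤ h)
  below []       empty = 0 , z≤n , ℤP.≤-reflexive (level-zero [])
  below (z ∷ zs) p with fromGaps-prefixHeight⁻ z zs p
  ... | inj₁ (j , _ , refl) =
    0 , z≤n , subst₂ _≤_ (trans (ℤP.*-zeroʳ (+ b)) (sym (level-zero (z ∷ zs)))) refl
                     (ℤP.*-monoˡ-≤-nonNeg (+ b) (Int.+≤+ z≤n))
  ... | inj₂ (h′ , q , refl) with below zs q
  ...   | j , j≤n , level≤h′ =
    suc j , s≤s j≤n ,
    subst (_≤ blockStep z + h′) (sym (level-suc z zs j)) (ℤP.+-monoʳ-≤ (blockStep z) level≤h′)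

  above : ∀ zs {h} → PrefixHeight (fromGaps zs) h → ∃[ j ] (j Nat.≤ length zs × h ≤ level zs j + + a)
  above []       empty =
    0 , z≤n , subst (λ l → + 0 ≤ l + + a) (sym (level-zero [])) (Int.+≤+ z≤n)
  above (z ∷ zs) p with fromGaps-prefixHeight⁻ z zs p
  ... | inj₁ (j , j≤z , refl) =
    1 , s≤s z≤n , subst (+ b * + j ≤_) (level-one z zs) (ℤP.*-monoˡ-≤-nonNeg (+ b) (Int.+≤+ j≤z))
  ... | inj₂ (h′ , q , refl) with above zs q
  ...   | j , j≤n , h′≤level =
    suc j , s≤s j≤n ,
    subst (blockStep z + h′ ≤_) (level-suc+a z zs j) (ℤP.+-monoʳ-≤ (blockStep z) h′≤level)

  BlackBalanced : List ℕ → Set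
  BlackBalanced zs = ∀ {i j} → i Nat.≤ length zs → j Nat.≤ length zs → level zs i < level zs j + + b

  -- Balance of the levels controls all heights, since these stay within
  -- [level, level + a].
  blackBalanced⇒balanced : ∀ zs → BlackBalanced zs → Balanced (fromGaps zs)
  blackBalanced⇒balanced zs bb {h} {h′} p p′ with above zs p | below zs p′
  ... | i , i≤n , h≤level | j , j≤n , level≤h′ = begin-strict
    h                        ≤⟨ h≤level ⟩
    level zs i + + a         <⟨ ℤP.+-monoˡ-< (+ a) (bb i≤n j≤n) ⟩
    level zs j + + b + + a   ≤⟨ ℤP.+-monoˡ-≤ (+ a) (ℤP.+-monoˡ-≤ (+ b) level≤h′) ⟩
    h′ + + b + + a           ≡⟨ identity h′ (+ a) (+ b) ⟩
    h′ + (+ a + + b)         ∎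
    where
    open ℤP.≤-Reasoning
    identity : ∀ (h a b : ℤ) → h + b + a ≡ h + (a + b)
    identity = solve-∀

  -- For a nonempty gap sequence returning to height 0, level i + a is a
  -- prefix height for every i ≤ length zs (for i = 0 use the last black bead).
  beforeLevel : ∀ zs {i} → 1 Nat.≤ length zs → level zs (length zs) ≡ + 0 → i Nat.≤ length zs →
                PrefixHeight (fromGaps zs) (level zs i + + a)
  beforeLevel (z ∷ zs) {zero}  _ closed _   =
    subst (λ l → PrefixHeight _ (l + + a)) (trans closed (sym (level-zero (z ∷ zs))))
          (beforeBlack (z ∷ zs) (length zs) ℕP.≤-refl)
  beforeLevel zs       {suc i} _ _      i<n = beforeBlack zs i i<n

  balanced⇒blackBalanced : ∀ zs → 1 Nat.≤ length zs → level zs (length zs) ≡ + 0 →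
                           Balanced (fromGaps zs) → BlackBalanced zs
  balanced⇒blackBalanced zs nonempty closed bal {i} {j} i≤n j≤n =
    <-by-offset (+ a) (bal (beforeLevel zs nonempty closed i≤n) (atBlack zs j j≤n))
      refl (identity (level zs j) (+ a) (+ b))
    where
    identity : ∀ (l a b : ℤ) → l + (a + b) ≡ l + b + a
    identity = solve-∀

module PrefixSums where
  open Nat using (_+_; _≤_; _<_)

  prefixSum-suc : ∀ zs m → m < length zs → prefixSum zs (suc m) ≡ prefixSum zs m + zs ! m
  prefixSum-suc (z ∷ zs) zero    _         = ℕP.+-comm z 0
  prefixSum-suc (z ∷ zs) (suc m) (s≤s m<n) =
    trans (cong (λ t → z + t) (prefixSum-suc zs m m<n)) (sym (ℕP.+-assoc z _ _))

  prefixSum-all : ∀ zs → prefixSum zs (length zs) ≡ sum zs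
  prefixSum-all zs = cong sum (take-all (length zs) zs ℕP.≤-refl)

  prefixSum-++ˡ : ∀ zs ws m → m ≤ length zs → prefixSum (zs ++ ws) m ≡ prefixSum zs m
  prefixSum-++ˡ zs       ws zero    _         = refl
  prefixSum-++ˡ (z ∷ zs) ws (suc m) (s≤s m≤n) = cong (λ t → z + t) (prefixSum-++ˡ zs ws m m≤n)

  prefixSum-++ʳ : ∀ zs ws m → prefixSum (zs ++ ws) (length zs + m) ≡ sum zs + prefixSum ws m
  prefixSum-++ʳ []       ws m = refl
  prefixSum-++ʳ (z ∷ zs) ws m =
    trans (cong (λ t → z + t) (prefixSum-++ʳ zs ws m)) (sym (ℕP.+-assoc z (sum zs) _))

  !-++ˡ : ∀ zs ws m → m < length zs → (zs ++ ws) ! m ≡ zs ! m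
  !-++ˡ (z ∷ zs) ws zero    _         = refl
  !-++ˡ (z ∷ zs) ws (suc m) (s≤s m<n) = !-++ˡ zs ws m m<n

  !-++ʳ : ∀ zs ws m → (zs ++ ws) ! (length zs + m) ≡ ws ! m
  !-++ʳ []       ws m = refl
  !-++ʳ (z ∷ zs) ws m = !-++ʳ zs ws m

-- Cyclic windows of a nonempty sequence ys are segments of ys ++ ys.
module Windows (x : ℕ) (xs : List ℕ) where
  open Nat using (_+_; _*_; _≤_; _<_; _/_; _%_; _≤?_)
  open PrefixSums

  ys : List ℕ
  ys = x ∷ xs

  b : ℕ
  b = length ys

  !-doubled : ∀ m → m < b + b → (ys ++ ys) ! m ≡ ys ! (m % b)
  !-doubled m m<2b with m Nat.<? b
  ... | yes m<b = trans (!-++ˡ ys ys m m<b) (cong (ys !_) (sym (m<n⇒m%n≡m m<b)))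
  ... | no  m≮b with ℕP.m≤n⇒∃[o]m+o≡n (ℕP.≮⇒≥ m≮b)
  ...   | e , refl = trans (!-++ʳ ys ys e) (cong (ys !_) (sym e≡[b+e]%b))
    where
    e≡[b+e]%b : (b + e) % b ≡ e
    e≡[b+e]%b = begin
      (b + e) % b  ≡⟨ cong (_% b) (ℕP.+-comm b e) ⟩
      (e + b) % b  ≡⟨ [m+n]%n≡m%n e b ⟩
      e % b        ≡⟨ m<n⇒m%n≡m (ℕP.+-cancelˡ-< b e b m<2b) ⟩
      e            ∎
      where open ≡-Reasoning

  windowSum-doubled : ∀ i k → i + k ≤ b + b →
    prefixSum (ys ++ ys) i + windowSum ys i k ≡ prefixSum (ys ++ ys) (i + k)
  windowSum-doubled i zero    _          =
    trans (ℕP.+-identityʳ _) (cong (prefixSum (ys ++ ys)) (sym (ℕP.+-identityʳ i)))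
  windowSum-doubled i (suc k) i+1+k≤2b = begin
    P i + (ys ! ((i + k) % b) + windowSum ys i k)
      ≡⟨ cong (λ t → P i + (t + windowSum ys i k)) (sym (!-doubled (i + k) i+k<2b)) ⟩
    P i + ((ys ++ ys) ! (i + k) + windowSum ys i k)
      ≡⟨ swap (P i) _ (windowSum ys i k) ⟩
    P i + windowSum ys i k + (ys ++ ys) ! (i + k)
      ≡⟨ cong (_+ (ys ++ ys) ! (i + k)) (windowSum-doubled i k (ℕP.<⇒≤ i+k<2b)) ⟩
    P (i + k) + (ys ++ ys) ! (i + k)
      ≡⟨ prefixSum-suc (ys ++ ys) (i + k) (subst (i + k <_) (sym (length-++ ys)) i+k<2b) ⟨
    P (suc (i + k))
      ≡⟨ cong P (ℕP.+-suc i k) ⟨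
    P (i + suc k)
      ∎
    where
    open ≡-Reasoning
    P : ℕ → ℕ
    P = prefixSum (ys ++ ys)
    i+k<2b : i + k < b + b
    i+k<2b = subst (_≤ b + b) (ℕP.+-suc i k) i+1+k≤2b
    swap : ∀ p q r → p + (q + r) ≡ p + r + q
    swap p q r = trans (cong (λ t → p + t) (ℕP.+-comm q r)) (sym (ℕP.+-assoc p r q))

  short⇒≤b : ∀ {k} → k ≤ 1 + b / 2 → k ≤ b
  short⇒≤b k≤half = ℕP.≤-trans k≤half (m/n<m b 2 (s≤s (s≤s z≤n)))

  short-complement : ∀ d d′ → d + d′ ≡ b → ¬ (d ≤ 1 + b / 2) → d′ ≤ 1 + b / 2
  short-complement d d′ d+d′≡b d-long with d′ ≤? 1 + b / 2
  ... | yes d′-short = d′-short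
  ... | no  d′-long  = contradiction both-long (ℕP.<⇒≱ b<4+2h)
    where
    h : ℕ
    h = b / 2
    b≤1+2h : b ≤ 1 + h * 2
    b≤1+2h = subst (_≤ 1 + h * 2) (sym (m≡m%n+[m/n]*n b 2))
                   (ℕP.+-monoˡ-≤ (h * 2) (ℕP.<⇒≤pred (m%n<n b 2)))
    b<4+2h : b < (2 + h) + (2 + h)
    b<4+2h = ℕP.≤-<-trans b≤1+2h (subst (1 + h * 2 <_) (regroup h) (ℕP.m<n+m (1 + h * 2) {3} (s≤s z≤n)))
      where
      regroup : ∀ h → 3 + (1 + h * 2) ≡ (2 + h) + (2 + h)
      regroup = NatSolver.solve-∀
    both-long : (2 + h) + (2 + h) ≤ b
    both-long = subst ((2 + h) + (2 + h) ≤_) d+d′≡b (ℕP.+-mono-≤ (ℕP.≰⇒> d-long) (ℕP.≰⇒> d′-long))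

Near : ℕ → ℤ → ℤ → Set
Near b x y = x Int.< y Int.+ + b × y Int.< x Int.+ + b

near-sym : ∀ {b x y} → Near b x y → Near b y x
near-sym (x<y+b , y<x+b) = y<x+b , x<y+b

-- If b·W + x = y + a·k, the two-sided estimate  a·k − b < b·W < a·k + b
-- (the window condition of Regular, cleared of denominators) says exactly
-- that x and y are near.
estimate⇔near : ∀ a b W k {x y} → + b Int.* + W Int.+ x ≡ y Int.+ + a Int.* + k →
  ((a Nat.* k Nat.< b Nat.* W Nat.+ b) × (b Nat.* W Nat.< a Nat.* k Nat.+ b)) ⇔ Near b x y
estimate⇔near a b W k {x} {y} eq = lower ×-⇔ upper
  where
  open Int using (_+_; _*_; _<_)
  bW ak : ℤ
  bW = + b * + W
  ak = + a * + k

  toℤ : ∀ {m n} → (m Nat.< n) ⇔ (+ m < + n)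
  toℤ = mk⇔ Int.+<+ ℤP.drop‿+<+

  lower : (a Nat.* k Nat.< b Nat.* W Nat.+ b) ⇔ (x < y + + b)
  lower = ⇔-trans toℤ (⇔-trans (<-offset x (cong (_+ x) (sym (ℤP.pos-* a k)))
                                           (cong (λ t → t + + b + x) (sym (ℤP.pos-* b W))))
                               (⇔-sym (<-offset ak (ℤP.+-comm ak x) via-eq)))
    where
    via-eq : bW + + b + x ≡ y + + b + ak
    via-eq = begin
      bW + + b + x      ≡⟨ identity bW (+ b) x ⟩
      bW + x + + b      ≡⟨ cong (_+ + b) eq ⟩
      y + ak + + b      ≡⟨ identity y ak (+ b) ⟩
      y + + b + ak      ∎
      where
      open ≡-Reasoning
      identity : ∀ (u v w : ℤ) → u + v + w ≡ u + w + v
      identity = solve-∀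

  upper : (b Nat.* W Nat.< a Nat.* k Nat.+ b) ⇔ (y < x + + b)
  upper = ⇔-trans toℤ (⇔-trans (<-offset x (cong (_+ x) (sym (ℤP.pos-* b W)))
                                           (cong (λ t → t + + b + x) (sym (ℤP.pos-* a k))))
                               (⇔-sym (<-offset ak eq (identity ak (+ b) x))))
    where
    identity : ∀ (u v w : ℤ) → u + v + w ≡ w + v + u
    identity = solve-∀

module Necklace (x : ℕ) (xs : List ℕ) where
  open Int using (_+_; _*_; _-_; _<_)
  open PrefixSums
  open Windows x xs public

  a : ℕ
  a = sum ys

  open Heights a b using (Balanced)
  open Levels a b

  level-closed : level ys b ≡ + 0
  level-closed = trans (cong (λ p → + b * + p - + a * + b) (prefixSum-all ys)) (identity (+ a) (+ b))
    where
    identity : ∀ (a b : ℤ) → b * a - a * b ≡ + 0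
    identity = solve-∀

  level₂ : ℕ → ℤ
  level₂ = level (ys ++ ys)

  level₂-low : ∀ {e} → e Nat.≤ b → level₂ e ≡ level ys e
  level₂-low {e} e≤b = cong (λ p → + b * + p - + a * + e) (prefixSum-++ˡ ys ys e e≤b)

  level₂-high : ∀ {e} → e Nat.≤ b → level₂ (b Nat.+ e) ≡ level ys e
  level₂-high {e} e≤b = begin
    + b * + prefixSum (ys ++ ys) (b Nat.+ e) - + a * + (b Nat.+ e)
      ≡⟨ cong (λ p → + b * + p - + a * + (b Nat.+ e)) (prefixSum-++ʳ ys ys e) ⟩
    + b * + (a Nat.+ prefixSum ys e) - + a * + (b Nat.+ e)
      ≡⟨ identity (+ a) (+ b) (+ prefixSum ys e) (+ e) ⟩
    + b * + prefixSum ys e - + a * + e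
      ∎
    where
    open ≡-Reasoning
    identity : ∀ (a b p e : ℤ) → b * (a + p) - a * (b + e) ≡ b * p - a * e
    identity = solve-∀

  level₂-fold : ∀ {m} → m Nat.≤ b Nat.+ b → ∃[ e ] (e Nat.≤ b × level₂ m ≡ level ys e)
  level₂-fold {m} m≤2b with m Nat.≤? b
  ... | yes m≤b = m , m≤b , level₂-low m≤b
  ... | no  m≰b with ℕP.m≤n⇒∃[o]m+o≡n (ℕP.<⇒≤ (ℕP.≰⇒> m≰b))
  ...   | e , refl = e , ℕP.+-cancelˡ-≤ b e b m≤2b , level₂-high (ℕP.+-cancelˡ-≤ b e b m≤2b)

  level₂-window : ∀ i k → i Nat.+ k Nat.≤ b Nat.+ b →
                  + b * + windowSum ys i k + level₂ i ≡ level₂ (i Nat.+ k) + + a * + k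
  level₂-window i k i+k≤2b = begin
    + b * + W + (+ b * + P i - + a * + i)
      ≡⟨ identity (+ b) (+ a) (+ W) (+ P i) (+ i) (+ k) ⟩
    + b * + (P i Nat.+ W) - + a * + (i Nat.+ k) + + a * + k
      ≡⟨ cong (λ p → + b * + p - + a * + (i Nat.+ k) + + a * + k) (windowSum-doubled i k i+k≤2b) ⟩
    level₂ (i Nat.+ k) + + a * + k
      ∎
    where
    open ≡-Reasoning
    W : ℕ
    W = windowSum ys i k
    P : ℕ → ℕ
    P = prefixSum (ys ++ ys)
    identity : ∀ (b a w p i k : ℤ) → b * w + (b * p - a * i) ≡ b * (p + w) - a * (i + k) + a * k
    identity = solve-∀

  window⇔near : ∀ i k → i Nat.+ k Nat.≤ b Nat.+ b →
    ((a Nat.* k Nat.< b Nat.* windowSum ys i k Nat.+ b) × (b Nat.* windowSum ys i k Nat.< a Nat.* k Nat.+ b))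
    ⇔ Near b (level₂ i) (level₂ (i Nat.+ k))
  window⇔near i k i+k≤2b = estimate⇔near a b (windowSum ys i k) k (level₂-window i k i+k≤2b)

  blackBalanced⇒regular : BlackBalanced ys → Regular a ys
  blackBalanced⇒regular bb i k i<b _ k-short = Equivalence.from (window⇔near i k i+k≤2b) near
    where
    i+k≤2b : i Nat.+ k Nat.≤ b Nat.+ b
    i+k≤2b = ℕP.+-mono-≤ (ℕP.<⇒≤ i<b) (short⇒≤b k-short)
    near : Near b (level₂ i) (level₂ (i Nat.+ k))
    near with level₂-fold (ℕP.≤-trans (ℕP.m≤m+n i k) i+k≤2b) | level₂-fold i+k≤2b
    ... | e , e≤b , eq | e′ , e′≤b , eq′ = subst₂ (Near b) (sym eq) (sym eq′) (bb e≤b e′≤b , bb e′≤b e≤b)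

  near-refl : ∀ l → Near b l l
  near-refl l = l<l+b , l<l+b
    where
    l<l+b : l < l + + b
    l<l+b = subst (_< l + + b) (ℤP.+-identityʳ l) (ℤP.+-monoʳ-< l (Int.+<+ (s≤s z≤n)))

  admissible-near : Regular a ys → ∀ {i k} → i Nat.< b → suc k Nat.≤ 1 Nat.+ b Nat./ 2 →
                    Near b (level₂ i) (level₂ (i Nat.+ suc k))
  admissible-near reg {i} {k} i<b k-short =
    Equivalence.to (window⇔near i (suc k) (ℕP.+-mono-≤ (ℕP.<⇒≤ i<b) (short⇒≤b k-short)))
                   (reg i (suc k) i<b (s≤s z≤n) k-short)

  -- Regularity makes the levels at any two positions p ≤ q < b near: if the
  -- window from p to q is admissible use it, otherwise the complementary
  -- window from q around to p is.
  regular⇒near : Regular a ys → ∀ {p q} → p Nat.≤ q → q Nat.< b → Near b (level ys p) (level ys q)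
  regular⇒near reg {p} p≤q q<b with ℕP.m≤n⇒∃[o]m+o≡n p≤q
  ... | zero , refl =
    subst (λ q → Near b (level ys p) (level ys q)) (sym (ℕP.+-identityʳ p)) (near-refl (level ys p))
  ... | suc d , refl with suc d Nat.≤? 1 Nat.+ b Nat./ 2
  ...   | yes short =
    subst₂ (Near b) (level₂-low (ℕP.≤-trans p≤q (ℕP.<⇒≤ q<b))) (level₂-low (ℕP.<⇒≤ q<b))
           (admissible-near reg (ℕP.≤-<-trans p≤q q<b) short)
  ...   | no  long with ℕP.m≤n⇒∃[o]m+o≡n (ℕP.≤-trans q<b (ℕP.m≤m+n b p))
  ...     | d′ , q+1+d′≡b+p =
    near-sym (subst₂ (Near b) (level₂-low (ℕP.<⇒≤ q<b)) (trans (cong level₂ q+d′≡b+p) (level₂-high p≤b))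
                     (admissible-near reg q<b (short-complement (suc d) (suc d′) d+d′≡b long)))
    where
    p≤b : p Nat.≤ b
    p≤b = ℕP.≤-trans p≤q (ℕP.<⇒≤ q<b)
    q+d′≡b+p : p Nat.+ suc d Nat.+ suc d′ ≡ b Nat.+ p
    q+d′≡b+p = trans (ℕP.+-suc (p Nat.+ suc d) d′) q+1+d′≡b+p
    d+d′≡b : suc d Nat.+ suc d′ ≡ b
    d+d′≡b = ℕP.+-cancelˡ-≡ p _ _ (begin
      p Nat.+ (suc d Nat.+ suc d′)   ≡⟨ ℕP.+-assoc p (suc d) (suc d′) ⟨
      p Nat.+ suc d Nat.+ suc d′     ≡⟨ q+d′≡b+p ⟩
      b Nat.+ p                      ≡⟨ ℕP.+-comm b p ⟩
      p Nat.+ b                      ∎)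
      where open ≡-Reasoning

  -- The level at position b equals the one at position 0.
  level-fold : ∀ {i} → i Nat.≤ b → ∃[ p ] (p Nat.< b × level ys i ≡ level ys p)
  level-fold {i} i≤b with i Nat.<? b
  ... | yes i<b = i , i<b , refl
  ... | no  i≮b with ℕP.≤-antisym i≤b (ℕP.≮⇒≥ i≮b)
  ...   | refl = 0 , s≤s z≤n , trans level-closed (sym (level-zero ys))

  regular⇒blackBalanced : Regular a ys → BlackBalanced ys
  regular⇒blackBalanced reg i≤b j≤b with level-fold i≤b | level-fold j≤b
  ... | p , p<b , eq | q , q<b , eq′ =
    subst₂ (λ u v → u < v + + b) (sym eq) (sym eq′) (proj₁ (near p<b q<b))
    where
    near : ∀ {p q} → p Nat.< b → q Nat.< b → Near b (level ys p) (level ys q)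
    near {p} {q} p<b q<b with ℕP.≤-total p q
    ... | inj₁ p≤q = regular⇒near reg p≤q q<b
    ... | inj₂ q≤p = near-sym (regular⇒near reg q≤p p<b)

  regular⇔blackBalanced : Regular a ys ⇔ BlackBalanced ys
  regular⇔blackBalanced = mk⇔ regular⇒blackBalanced blackBalanced⇒regular

  regular⇔balanced-fromGaps : Regular a ys ⇔ Balanced (fromGaps ys)
  regular⇔balanced-fromGaps = ⇔-trans regular⇔blackBalanced
    (mk⇔ (blackBalanced⇒balanced ys) (balanced⇒blackBalanced ys (s≤s z≤n) level-closed))

blocks-spec : ∀ w → w ≡ fromGaps (proj₁ (blocks w)) ++ replicate (proj₂ (blocks w)) true
blocks-spec []          = refl
blocks-spec (true ∷ w)  with blocks w | blocks-spec w
... | []     , t | eq = cong (true ∷_) eq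
... | r ∷ rs , t | eq = cong (true ∷_) eq
blocks-spec (false ∷ w) with blocks w | blocks-spec w
... | rs     , t | eq = cong (false ∷_) eq

blocks-red : ∀ w → sum (proj₁ (blocks w)) Nat.+ proj₂ (blocks w) ≡ countRed w
blocks-red []          = refl
blocks-red (true ∷ w)  with blocks w | blocks-red w
... | []     , t | eq = cong suc eq
... | r ∷ rs , t | eq = cong suc eq
blocks-red (false ∷ w) with blocks w | blocks-red w
... | rs     , t | eq = eq

blocks-black : ∀ w → length (proj₁ (blocks w)) ≡ countBlack w
blocks-black []          = refl
blocks-black (true ∷ w)  with blocks w | blocks-black w
... | []     , t | eq = eq
... | r ∷ rs , t | eq = eq
blocks-black (false ∷ w) with blocks w | blocks-black w
... | rs     , t | eq = cong suc eq

fromGaps-rotate : ∀ r rs t → fromGaps ((t Nat.+ r) ∷ rs) ≡ replicate t true ++ fromGaps (r ∷ rs)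
fromGaps-rotate r rs t = begin
  replicate (t Nat.+ r) true ++ false ∷ fromGaps rs
    ≡⟨ cong (_++ false ∷ fromGaps rs) (replicate-+ t r) ⟩
  (replicate t true ++ replicate r true) ++ false ∷ fromGaps rs
    ≡⟨ ++-assoc (replicate t true) (replicate r true) (false ∷ fromGaps rs) ⟩
  replicate t true ++ fromGaps (r ∷ rs)
    ∎
  where
  open ≡-Reasoning
  replicate-+ : ∀ m n → replicate (m Nat.+ n) true ≡ replicate m true ++ replicate n true
  replicate-+ zero    n = refl
  replicate-+ (suc m) n = cong (true ∷_) (replicate-+ m n)

regular⇔balanced : ∀ a b w → countRed w ≡ a → countBlack w ≡ b → 1 Nat.≤ b →
                   Regular a (charSeq w) ⇔ Heights.Balanced a b w
regular⇔balanced a b w red black 1≤b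
  with blocks w | blocks-spec w | blocks-red w | blocks-black w
... | []     , t | _    | _    | no-gaps =
  contradiction (subst (1 Nat.≤_) (sym (trans no-gaps black)) 1≤b) λ ()
... | r ∷ rs , t | refl | reds | gaps
  -- a and b are the sum and the length of the characteristic sequence (t + r) ∷ rs
  with trans (ℕP.+-assoc t r (sum rs)) (trans (ℕP.+-comm t _) (trans reds red)) | trans gaps black
...   | refl | refl = ⇔-trans Nk.regular⇔balanced-fromGaps rotated
  where
  module Nk = Necklace (t Nat.+ r) rs
  open Heights Nk.a Nk.b
  open Levels Nk.a Nk.b using (total-fromGaps)
  gapWord tail : List Bool
  gapWord = fromGaps (r ∷ rs)
  tail    = replicate t true
  closed : total (tail ++ gapWord) ≡ + 0
  closed = trans (cong total (sym (fromGaps-rotate r rs t)))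
                 (trans (total-fromGaps Nk.ys) Nk.level-closed)
  rotated : Balanced (fromGaps Nk.ys) ⇔ Balanced (gapWord ++ tail)
  rotated = subst (λ u → Balanced u ⇔ Balanced (gapWord ++ tail)) (sym (fromGaps-rotate r rs t))
                  (balanced-rotate⇔ tail gapWord closed)

countRed-dual : ∀ w → countRed (dual w) ≡ countBlack w
countRed-dual []          = refl
countRed-dual (true ∷ w)  = countRed-dual w
countRed-dual (false ∷ w) = cong suc (countRed-dual w)

countBlack-dual : ∀ w → countBlack (dual w) ≡ countRed w
countBlack-dual w = trans (sym (countRed-dual (dual w))) (cong countRed (dual-involutive w))

lemma2 : (a b : ℕ) → 1 Nat.≤ a → 1 Nat.≤ b → (w : List Bool) →
         countRed w ≡ a → countBlack w ≡ b →
         Regular a (charSeq w) ⇔ Regular b (charSeq (dual w))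
lemma2 a b 1≤a 1≤b w red black =
  ⇔-trans (regular⇔balanced a b w red black 1≤b)
          (⇔-trans balanced⇔dual-balanced
                   (⇔-sym (regular⇔balanced b a (dual w) red* black* 1≤a)))
  where
  red* : countRed (dual w) ≡ b
  red* = trans (countRed-dual w) black
  black* : countBlack (dual w) ≡ a
  black* = trans (countBlack-dual w) red
  balanced⇔dual-balanced : Heights.Balanced a b w ⇔ Heights.Balanced b a (dual w)
  balanced⇔dual-balanced = mk⇔ (balanced-dual a b w)
    (λ bal* → subst (Heights.Balanced a b) (dual-involutive w) (balanced-dual b a (dual w) bal*))
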